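{- Let $G$ be a graph containing no subgraph isomorphic to $C_6$, let $x\in V(G)$, and let $A$ be a bipartite connected component of $G[N_2(x)]$ with bipartition classes $V_1$ and $V_2$. Then for each $i\in\{1,2\}$, if $|V_i|\ge 2$ then $|N(x)\cap N(V_i)|=1$.
   Context: Graphs are finite, simple, undirected. For a nonempty set $S$ of vertices, $N(S)$ is the set of vertices at distance exactly $1$ from $S$; $N(x)=N(\{x\})$; $N_2(x)$ is the set of vertices at distance exactly $2$ from $x$. "No subgraph isomorphic to $C_6$" refers to not necessarily induced subgraphs. -}

module Defs where

open import Data.Nat using (ℕ)
open import Data.Bool using (Bool; true; false; not; _∧_; T)
open import Data.Bool.Properties using (T?)
open import Data.Fin using (Fin; zero; suc; _≟_)
open import Data.Fin.Properties using (any?)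
open import Data.Fin.Subset using (Subset; _∈_; _⊆_; Nonempty)
open import Data.Vec using (tabulate; lookup)
open import Data.Product using (Σ; _×_)
open import Data.Sum using (_⊎_)
open import Data.Empty using (⊥)
open import Function.Definitions using (Injective)
open import Relation.Nullary using (does; ¬_)
open import Relation.Binary.PropositionalEquality using (_≡_)

record Graph (n : ℕ) : Set where
  field
    adj        : Fin n → Fin n → Bool
    adj-sym    : ∀ u v → adj u v ≡ adj v u
    adj-irrefl : ∀ u → adj u u ≡ false
open Graph public

Edge : ∀ {n} → Graph n → Fin n → Fin n → Set
Edge G u v = T (adj G u v)

next6 : Fin 6 → Fin 6
next6 zero = suc zero
next6 (suc zero) = suc (suc zero)
next6 (suc (suc zero)) = suc (suc (suc zero))
next6 (suc (suc (suc zero))) = suc (suc (suc (suc zero)))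
next6 (suc (suc (suc (suc zero)))) = suc (suc (suc (suc (suc zero))))
next6 (suc (suc (suc (suc (suc zero))))) = zero

HasC6 : ∀ {n} → Graph n → Set
HasC6 {n} G = Σ (Fin 6 → Fin n) λ f →
  Injective _≡_ _≡_ f × (∀ i → Edge G (f i) (f (next6 i)))

Nbr : ∀ {n} → Graph n → Fin n → Subset n
Nbr G x = tabulate λ y → adj G x y

N2 : ∀ {n} → Graph n → Fin n → Subset n
N2 G x = tabulate λ y →
  not (does (x ≟ y)) ∧ not (adj G x y) ∧ does (any? λ z → T? (adj G x z ∧ adj G z y))

NSet : ∀ {n} → Graph n → Subset n → Subset n
NSet G S = tabulate λ y →
  not (lookup S y) ∧ does (any? λ z → T? (lookup S z ∧ adj G z y))

data WalkIn {n} (G : Graph n) (S : Subset n) : Fin n → Fin n → Set where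
  here : ∀ {u} → u ∈ S → WalkIn G S u u
  step : ∀ {u v w} → u ∈ S → Edge G u v → WalkIn G S v w → WalkIn G S u w

IsComponent : ∀ {n} → Graph n → Subset n → Subset n → Set
IsComponent G S A =
  Nonempty A × A ⊆ S ×
  (∀ {u v} → u ∈ A → v ∈ A → WalkIn G A u v) ×
  (∀ {u v} → u ∈ A → v ∈ S → Edge G u v → v ∈ A)

IsBipartition : ∀ {n} → Graph n → Subset n → Subset n → Subset n → Set
IsBipartition G A V₁ V₂ =
  (∀ u → u ∈ A → u ∈ V₁ ⊎ u ∈ V₂) ×
  V₁ ⊆ A × V₂ ⊆ A ×
  (∀ u → u ∈ V₁ → u ∈ V₂ → ⊥) ×
  (∀ u v → u ∈ V₁ → v ∈ V₁ → ¬ Edge G u v) ×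
  (∀ u v → u ∈ V₂ → v ∈ V₂ → ¬ Edge G u v)

module Submission where

-- Call y an attachment of u ∈ N₂(x) if x ~ y ~ u.  If a ≠ b in
-- N₂(x) have a common neighbour w ∈ N₂(x), then any attachment y of a equals
-- any attachment y' of b: otherwise x y a w b y' would be a 6-cycle.  So a and
-- b share a single attachment.  In a bipartite component A of G[N₂(x)], two
-- vertices of the same class V are joined by a walk in A that alternates
-- between the classes, so consecutive V-vertices of it have a common
-- neighbour in A; chaining the previous fact along the walk, any two vertices
-- of V are equal or share their attachment.  When |V| ≥ 2 every vertex of V
-- has a partner distinct from it, hence all of V has one common attachment y,
-- and N(x) ∩ N(V) = {y}.

open import Defs
open import Data.Nat using (_≥_; _≤_; s≤s)
open import Data.Bool using (Bool; not; _∧_; T)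
open import Data.Bool.Properties using (T-≡; T-∧; T?)
open import Data.Fin using (Fin; zero; suc; _≟_)
open import Data.Fin.Properties using (suc-injective; any?)
open import Data.Fin.Subset using (Subset; _∩_; ∣_∣; _∈_; _⊆_; ⁅_⁆; Nonempty; inside; outside)
open import Data.Fin.Subset.Properties using (x∈⁅x⁆; x∈⁅y⁆⇒x≡y; ∣⁅x⁆∣≡1; ⊆-antisym; x∈p∩q⁺; x∈p∩q⁻)
open import Data.Vec using (Vec; []; _∷_; tabulate; lookup; here; there)
open import Data.Vec.Properties using (lookup∘tabulate; []=⇒lookup; lookup⇒[]=)
open import Data.Vec.Relation.Unary.All using ([]; _∷_)
open import Data.Vec.Relation.Unary.AllPairs using ([]; _∷_)
open import Data.Vec.Relation.Unary.Unique.Propositional using (Unique)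
open import Data.Vec.Relation.Unary.Unique.Propositional.Properties using (lookup-injective)
open import Data.Product using (∃; ∃₂; _×_; _,_; proj₁; proj₂)
open import Data.Sum using (_⊎_; inj₁; inj₂; swap)
open import Data.Empty using (⊥-elim)
open import Data.Unit using (tt)
open import Function using (_∘_)
open import Function.Bundles using (Equivalence)
open import Relation.Nullary using (¬_; Dec; does; yes; no)
open import Relation.Binary.PropositionalEquality using (_≡_; _≢_; refl; sym; trans; subst; cong; ≢-sym)

open Equivalence using (to; from)

∈⇒T : ∀ {n} {p : Subset n} {i} → i ∈ p → T (lookup p i)
∈⇒T i∈p = from T-≡ ([]=⇒lookup i∈p)

T⇒∈ : ∀ {n} {p : Subset n} {i} → T (lookup p i) → i ∈ p
T⇒∈ t = lookup⇒[]= _ _ (to T-≡ t)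

∈-tabulate⁻ : ∀ {n} {f : Fin n → Bool} {i} → i ∈ tabulate f → T (f i)
∈-tabulate⁻ {f = f} {i} i∈ = subst T (lookup∘tabulate f i) (∈⇒T i∈)

∈-tabulate⁺ : ∀ {n} {f : Fin n → Bool} {i} → T (f i) → i ∈ tabulate f
∈-tabulate⁺ {f = f} {i} t = T⇒∈ (subst T (sym (lookup∘tabulate f i)) t)

does⁻ : ∀ {A : Set} (d : Dec A) → T (does d) → A
does⁻ (yes a) _ = a

does⁺ : ∀ {A : Set} (d : Dec A) → A → T (does d)
does⁺ (yes _) _ = tt
does⁺ (no ¬a) a = ¬a a

not-does⁻ : ∀ {A : Set} (d : Dec A) → T (not (does d)) → ¬ A
not-does⁻ (no ¬a) _ = ¬a

not-does⁺ : ∀ {A : Set} (d : Dec A) → ¬ A → T (not (does d))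
not-does⁺ (yes a) ¬a = ¬a a
not-does⁺ (no _) _ = tt

nonempty : ∀ {n} (p : Subset n) → 1 ≤ ∣ p ∣ → Nonempty p
nonempty (inside ∷ p) _ = zero , here
nonempty (outside ∷ p) h with nonempty p h
... | i , i∈p = suc i , there i∈p

two-elements : ∀ {n} (p : Subset n) → 2 ≤ ∣ p ∣ →
               ∃₂ λ u v → u ∈ p × v ∈ p × u ≢ v
two-elements (inside ∷ p) (s≤s h) with nonempty p h
... | v , v∈p = zero , suc v , here , there v∈p , λ ()
two-elements (outside ∷ p) h with two-elements p h
... | u , v , u∈p , v∈p , u≢v =
  suc u , suc v , there u∈p , there v∈p , u≢v ∘ suc-injective

singleton-size : ∀ {n} {p : Subset n} {y} →
                 y ∈ p → (∀ {z} → z ∈ p → z ≡ y) → ∣ p ∣ ≡ 1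
singleton-size {p = p} {y} y∈p only-y =
  trans (cong ∣_∣ (⊆-antisym p⊆⁅y⁆ ⁅y⁆⊆p)) (∣⁅x⁆∣≡1 y)
  where
  p⊆⁅y⁆ : p ⊆ ⁅ y ⁆
  p⊆⁅y⁆ z∈p = subst (_∈ ⁅ y ⁆) (sym (only-y z∈p)) (x∈⁅x⁆ y)
  ⁅y⁆⊆p : ⁅ y ⁆ ⊆ p
  ⁅y⁆⊆p {z} z∈ = subst (_∈ p) (sym (x∈⁅y⁆⇒x≡y y z∈)) y∈p

module Basics {n} (G : Graph n) where

  edge-sym : ∀ {u v} → Edge G u v → Edge G v u
  edge-sym {u} {v} = subst T (adj-sym G u v)

  edge-irrefl : ∀ {u v} → Edge G u v → u ≢ v
  edge-irrefl {u} e refl = subst T (adj-irrefl G u) e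

  hexagon : (vs : Vec (Fin n) 6) → Unique vs →
            (∀ i → Edge G (lookup vs i) (lookup vs (next6 i))) → HasC6 G
  hexagon vs distinct edges =
    lookup vs , (λ {i} {j} → lookup-injective distinct i j) , edges

  walk-start : ∀ {S u v} → WalkIn G S u v → u ∈ S
  walk-start (here u∈S) = u∈S
  walk-start (step u∈S _ _) = u∈S

  swap-classes : ∀ {A V₁ V₂} → IsBipartition G A V₁ V₂ → IsBipartition G A V₂ V₁
  swap-classes (cover , V₁⊆A , V₂⊆A , disjoint , indep₁ , indep₂) =
    (λ u u∈A → swap (cover u u∈A)) , V₂⊆A , V₁⊆A ,
    (λ u u₂ u₁ → disjoint u u₁ u₂) , indep₂ , indep₁

  cross : ∀ {A V₁ V₂ u v} → IsBipartition G A V₁ V₂ →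
          u ∈ V₁ → v ∈ A → Edge G u v → v ∈ V₂
  cross {v = v} (cover , _ , _ , _ , indep₁ , _) u₁ v∈A u~v with cover v v∈A
  ... | inj₁ v₁ = ⊥-elim (indep₁ _ _ u₁ v₁ u~v)
  ... | inj₂ v₂ = v₂

module Around {n} (G : Graph n) (x : Fin n) where

  open Basics G

  Attachment : Fin n → Fin n → Set
  Attachment u y = Edge G x y × Edge G y u

  ∈N2⁻ : ∀ {u} → u ∈ N2 G x → x ≢ u × ¬ Edge G x u × ∃ (Attachment u)
  ∈N2⁻ {u} u∈ with to T-∧ (∈-tabulate⁻ u∈)
  ... | x≢u , rest with to T-∧ rest
  ...   | x≁u , attached
          with does⁻ (any? λ z → T? (adj G x z ∧ adj G z u)) attached
  ...     | y , x~y~u =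
    not-does⁻ (x ≟ u) x≢u , not-does⁻ (T? (adj G x u)) x≁u , y , to T-∧ x~y~u

  N2⇒≢ : ∀ {u} → u ∈ N2 G x → x ≢ u
  N2⇒≢ = proj₁ ∘ ∈N2⁻

  N2⇒attachment : ∀ {u} → u ∈ N2 G x → ∃ (Attachment u)
  N2⇒attachment = proj₂ ∘ proj₂ ∘ ∈N2⁻

  neighbour≢N2 : ∀ {y u} → Edge G x y → u ∈ N2 G x → y ≢ u
  neighbour≢N2 x~y u∈ refl = proj₁ (proj₂ (∈N2⁻ u∈)) x~y

  ∈N∩NSet⁻ : ∀ {S z} → z ∈ Nbr G x ∩ NSet G S → ∃ λ a → a ∈ S × Attachment a z
  ∈N∩NSet⁻ {S = S} {z} z∈ with x∈p∩q⁻ _ _ z∈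
  ... | z∈N , z∈NS
        with does⁻ (any? λ a → T? (lookup S a ∧ adj G a z))
                   (proj₂ (to T-∧ (∈-tabulate⁻ z∈NS)))
  ...   | a , a∈S∧a~z with to T-∧ a∈S∧a~z
  ...     | a∈S , a~z = a , T⇒∈ a∈S , ∈-tabulate⁻ z∈N , edge-sym a~z

  ∈N∩NSet⁺ : ∀ {S a z} → S ⊆ N2 G x → a ∈ S → Attachment a z →
             z ∈ Nbr G x ∩ NSet G S
  ∈N∩NSet⁺ {S = S} {a} {z} S⊆N2 a∈S (x~z , z~a) =
    x∈p∩q⁺ (∈-tabulate⁺ x~z , ∈-tabulate⁺ (from T-∧ (z∉S , z-has-S-neighbour)))
    where
    z∉S : T (not (lookup S z))
    z∉S = not-does⁺ (T? (lookup S z)) λ z∈S →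
            neighbour≢N2 x~z (S⊆N2 (T⇒∈ z∈S)) refl
    z-has-S-neighbour : T (does (any? λ b → T? (lookup S b ∧ adj G b z)))
    z-has-S-neighbour =
      does⁺ (any? λ b → T? (lookup S b ∧ adj G b z)) (a , from T-∧ (∈⇒T a∈S , edge-sym z~a))

  Shared : Fin n → Fin n → Set
  Shared a b = ∀ {y y'} → Attachment a y → Attachment b y' → y ≡ y'

  Shared-sym : ∀ {a b} → Shared a b → Shared b a
  Shared-sym ab by ay' = sym (ab ay' by)

  Shared-trans : ∀ {a b c} → b ∈ N2 G x → Shared a b → Shared b c → Shared a c
  Shared-trans b∈ ab bc ay cy' with N2⇒attachment b∈
  ... | z , bz = trans (ab ay bz) (bc bz cy')

  unique-attachment : ∀ {V u} → V ⊆ N2 G x → u ∈ V →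
                      (∀ {a b} → a ∈ V → b ∈ V → Shared a b) →
                      ∣ Nbr G x ∩ NSet G V ∣ ≡ 1
  unique-attachment {V} V⊆N2 u∈V shared with N2⇒attachment (V⊆N2 u∈V)
  ... | y , u-y = singleton-size (∈N∩NSet⁺ V⊆N2 u∈V u-y) only-y
    where
    only-y : ∀ {z} → z ∈ Nbr G x ∩ NSet G V → z ≡ y
    only-y z∈ with ∈N∩NSet⁻ {S = V} z∈
    ... | a , a∈V , a-z = shared a∈V u∈V a-z u-y

module WithoutHexagon {n} (G : Graph n) (noC6 : ¬ HasC6 G) (x : Fin n) where

  open Basics G
  open Around G x

  -- The central use of the hypothesis: distinct a, b ∈ N₂(x) with a common
  -- neighbour w ∈ N₂(x) share their attachment, since attachments y ≠ y' of
  -- a and b would close the 6-cycle x y a w b y'.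
  common-neighbour⇒Shared : ∀ {a b w} → a ∈ N2 G x → b ∈ N2 G x → w ∈ N2 G x →
                            a ≢ b → Edge G a w → Edge G w b → Shared a b
  common-neighbour⇒Shared {a} {b} {w} a∈ b∈ w∈ a≢b a~w w~b
                          {y} {y'} (x~y , y~a) (x~y' , y'~b) with y ≟ y'
  ... | yes y≡y' = y≡y'
  ... | no y≢y' = ⊥-elim (noC6 (hexagon (x ∷ y ∷ a ∷ w ∷ b ∷ y' ∷ []) distinct edges))
    where
    -- {x}, N(x) and N₂(x) are pairwise disjoint, y ≠ y', and a, w, b are
    -- pairwise distinct since a ~ w ~ b and a ≠ b.
    distinct : Unique (x ∷ y ∷ a ∷ w ∷ b ∷ y' ∷ [])
    distinct =
      (edge-irrefl x~y ∷ N2⇒≢ a∈ ∷ N2⇒≢ w∈ ∷ N2⇒≢ b∈ ∷ edge-irrefl x~y' ∷ []) ∷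
      (neighbour≢N2 x~y a∈ ∷ neighbour≢N2 x~y w∈ ∷ neighbour≢N2 x~y b∈ ∷ y≢y' ∷ []) ∷
      (edge-irrefl a~w ∷ a≢b ∷ ≢-sym (neighbour≢N2 x~y' a∈) ∷ []) ∷
      (edge-irrefl w~b ∷ ≢-sym (neighbour≢N2 x~y' w∈) ∷ []) ∷
      (≢-sym (neighbour≢N2 x~y' b∈) ∷ []) ∷
      [] ∷ []
    edges : ∀ i → Edge G (lookup (x ∷ y ∷ a ∷ w ∷ b ∷ y' ∷ []) i)
                         (lookup (x ∷ y ∷ a ∷ w ∷ b ∷ y' ∷ []) (next6 i))
    edges zero = x~y
    edges (suc zero) = y~a
    edges (suc (suc zero)) = a~w
    edges (suc (suc (suc zero))) = w~b
    edges (suc (suc (suc (suc zero)))) = edge-sym y'~b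
    edges (suc (suc (suc (suc (suc zero))))) = edge-sym x~y'

  Linked : Fin n → Fin n → Set
  Linked a b = a ≡ b ⊎ Shared a b

  Linked-trans : ∀ {a b c} → b ∈ N2 G x → Linked a b → Linked b c → Linked a c
  Linked-trans _ (inj₁ refl) bc = bc
  Linked-trans _ ab (inj₁ refl) = ab
  Linked-trans b∈ (inj₂ ab) (inj₂ bc) = inj₂ (Shared-trans b∈ ab bc)

  common-neighbour⇒Linked : ∀ {a b w} → a ∈ N2 G x → b ∈ N2 G x → w ∈ N2 G x →
                            Edge G a w → Edge G w b → Linked a b
  common-neighbour⇒Linked {a} {b} a∈ b∈ w∈ a~w w~b with a ≟ b
  ... | yes a≡b = inj₁ a≡b
  ... | no a≢b = inj₂ (common-neighbour⇒Shared a∈ b∈ w∈ a≢b a~w w~b)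

  -- In a bipartite A ⊆ N₂(x), two vertices of the same class joined by a walk
  -- in A are linked: the walk alternates between the classes, so its
  -- vertices in the class of u come in steps u ~ w ~ u' through A.
  walk⇒Linked : ∀ {A V₁ V₂ u v} → A ⊆ N2 G x → IsBipartition G A V₁ V₂ →
                u ∈ V₁ → v ∈ V₁ → WalkIn G A u v → Linked u v
  walk⇒Linked _ _ _ _ (here _) = inj₁ refl
  walk⇒Linked _ (_ , _ , _ , _ , indep₁ , _) u₁ v₁ (step _ u~v (here _)) =
    ⊥-elim (indep₁ _ _ u₁ v₁ u~v)
  walk⇒Linked A⊆N2 bip u₁ v₁ (step u∈A u~w (step w∈A w~u' rest)) =
    Linked-trans (A⊆N2 u'∈A)
      (common-neighbour⇒Linked (A⊆N2 u∈A) (A⊆N2 u'∈A) (A⊆N2 w∈A) u~w w~u')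
      (walk⇒Linked A⊆N2 bip u'₁ v₁ rest)
    where
    u'∈A = walk-start rest
    u'₁ = cross (swap-classes bip) (cross bip u₁ w∈A u~w) u'∈A w~u'

  -- In a bipartite component A of G[N₂(x)], if a class V has two distinct
  -- vertices then any two vertices of V share their attachment: distinct ones
  -- by connectivity, and a vertex with itself through a partner distinct from it.
  class-Shared : ∀ {A V W u v} → IsComponent G (N2 G x) A → IsBipartition G A V W →
                 u ∈ V → v ∈ V → u ≢ v → ∀ {a b} → a ∈ V → b ∈ V → Shared a b
  class-Shared {V = V} {u = u} {v} (_ , A⊆N2 , connected , _) bip@(_ , V⊆A , _)
               u∈ v∈ u≢v = shared
    where
    distinct⇒Shared : ∀ {a b} → a ∈ V → b ∈ V → a ≢ b → Shared a b
    distinct⇒Shared a∈ b∈ a≢b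
      with walk⇒Linked A⊆N2 bip a∈ b∈ (connected (V⊆A a∈) (V⊆A b∈))
    ... | inj₁ a≡b = ⊥-elim (a≢b a≡b)
    ... | inj₂ ab = ab

    partner : ∀ {a} → a ∈ V → ∃ λ c → c ∈ V × a ≢ c
    partner {a} _ with a ≟ u
    ... | yes refl = v , v∈ , u≢v
    ... | no a≢u = u , u∈ , a≢u

    shared : ∀ {a b} → a ∈ V → b ∈ V → Shared a b
    shared {a} {b} a∈ b∈ with a ≟ b
    ... | no a≢b = distinct⇒Shared a∈ b∈ a≢b
    ... | yes refl with partner a∈
    ...   | c , c∈ , a≢c = Shared-trans (A⊆N2 (V⊆A c∈)) ac (Shared-sym ac)
      where
      ac : Shared a c
      ac = distinct⇒Shared a∈ c∈ a≢c

lemma4 : ∀ {n} (G : Graph n) → ¬ HasC6 G → (x : Fin n) →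
         (A V₁ V₂ : Subset n) → IsComponent G (N2 G x) A →
         IsBipartition G A V₁ V₂ →
         (∣ V₁ ∣ ≥ 2 → ∣ Nbr G x ∩ NSet G V₁ ∣ ≡ 1) ×
         (∣ V₂ ∣ ≥ 2 → ∣ Nbr G x ∩ NSet G V₂ ∣ ≡ 1)
lemma4 G noC6 x A V₁ V₂ comp@(_ , A⊆N2 , _) bip =
  class-bound bip , class-bound (swap-classes bip)
  where
  open Basics G
  open Around G x
  open WithoutHexagon G noC6 x

  class-bound : ∀ {V W} → IsBipartition G A V W → ∣ V ∣ ≥ 2 →
                ∣ Nbr G x ∩ NSet G V ∣ ≡ 1
  class-bound bip'@(_ , V⊆A , _) size with two-elements _ size
  ... | u , v , u∈ , v∈ , u≢v =
    unique-attachment (A⊆N2 ∘ V⊆A) u∈ (class-Shared comp bip' u∈ v∈ u≢v)
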